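{- For every $n\ge 3$, let $G_n^5$ be the graph on vertex set $\{a_1,\dots,a_n,b_1,\dots,b_n\}$ whose non-edges are exactly the $2n$ pairs of consecutive vertices on the cycle $a_1,b_1,a_2,b_2,\dots,a_n,b_n,a_1$ (i.e. $\{a_i,b_i\}$ for $1\le i\le n$, $\{b_i,a_{i+1}\}$ for $1\le i\le n-1$, and $\{b_n,a_1\}$), all other pairs of distinct vertices being adjacent. Then $G_n^5$ is word-representable.
   Context: All graphs are finite and simple. For a word $w$ and letters $i,j$, let $w_{ij}$ be the subsequence of $w$ consisting of all occurrences of $i$ and $j$; $i$ and $j$ alternate in $w$ if $w_{ij}$ contains no factor $ii$ or $jj$. A graph $G$ is word-representable if there is a word $w$ over $V(G)$ such that for all distinct $i,j\in V(G)$, $\{i,j\}\in E(G)$ if and only if $i$ and $j$ alternate in $w$. -}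

module Defs where

open import Data.Nat using (ℕ; zero; suc; _+_; _≥_)
open import Data.Fin using (Fin; toℕ)
import Data.Fin.Properties as FinP
open import Data.Sum using (inj₁; inj₂; swap)
open import Data.Product using (proj₁; proj₂; _,_)
open import Relation.Nullary using (yes; no)
open import Relation.Binary.PropositionalEquality using (refl; sym; cong)
open import Data.List using (List; []; _∷_; filter)
open import Data.Product using (_×_; Σ; ∃)
open import Data.Sum using (_⊎_)
open import Data.Empty using (⊥)
open import Data.Unit using (⊤)
open import Relation.Nullary using (¬_; Dec)
open import Relation.Nullary.Decidable using (_⊎-dec_)
open import Relation.Binary.PropositionalEquality using (_≡_; _≢_)
open import Relation.Binary.Definitions using (DecidableEquality)
open import Function.Bundles using (_⇔_)

record Graph : Set₁ where
  field
    V       : Set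
    _≟V_    : DecidableEquality V
    E       : V → V → Set
    E-sym   : ∀ {x y} → E x y → E y x
    E-irr   : ∀ {x} → ¬ E x x

NoRepeatFactor : {A : Set} → List A → Set
NoRepeatFactor []           = ⊤
NoRepeatFactor (x ∷ [])     = ⊤
NoRepeatFactor (x ∷ y ∷ xs) = (x ≢ y) × NoRepeatFactor (y ∷ xs)

restrict : {A : Set} → DecidableEquality A → A → A → List A → List A
restrict _≟_ i j w = filter (λ z → (z ≟ i) ⊎-dec (z ≟ j)) w

Alternate : {A : Set} → DecidableEquality A → List A → A → A → Set
Alternate _≟_ w i j = NoRepeatFactor (restrict _≟_ i j w)

WordRepresentable : Graph → Set
WordRepresentable G =
  Σ (List V) λ w → ∀ (i j : V) → i ≢ j → (E i j ⇔ Alternate _≟V_ w i j)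
  where open Graph G

-- Vertices a_1..a_n, b_1..b_n (0-indexed: a i, b i with i : Fin n)
data Vtx (n : ℕ) : Set where
  a : Fin n → Vtx n
  b : Fin n → Vtx n

-- the non-edges of G_n^5 (as unordered pairs, either orientation):
-- {a_i,b_i}, {b_i,a_{i+1}} (i < n-1 in 0-indexing), {b_n,a_1}
NonEdge₀ : (n : ℕ) → Vtx n → Vtx n → Set
NonEdge₀ n (a i) (b j) = toℕ i ≡ toℕ j
NonEdge₀ n (b i) (a j) = (toℕ j ≡ suc (toℕ i)) ⊎ ((suc (toℕ i) ≡ n) × (toℕ j ≡ 0))
NonEdge₀ n _ _ = ⊥

NonEdge : (n : ℕ) → Vtx n → Vtx n → Set
NonEdge n x y = NonEdge₀ n x y ⊎ NonEdge₀ n y x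

Adj5 : (n : ℕ) → Vtx n → Vtx n → Set
Adj5 n x y = (x ≢ y) × ¬ NonEdge n x y

_≟Vtx_ : {n : ℕ} → DecidableEquality (Vtx n)
a i ≟Vtx a j with i FinP.≟ j
... | yes refl = yes refl
... | no ne = no λ { refl → ne refl }
a i ≟Vtx b j = no λ ()
b i ≟Vtx a j = no λ ()
b i ≟Vtx b j with i FinP.≟ j
... | yes refl = yes refl
... | no ne = no λ { refl → ne refl }

G5 : ℕ → Graph
G5 n = record
  { V     = Vtx n
  ; _≟V_  = _≟Vtx_
  ; E     = Adj5 n
  ; E-sym = λ { (ne , nn) → (λ eq → ne (sym eq)) , (λ p → nn (swap p)) }
  ; E-irr = λ { (ne , _) → ne refl }
  }

{-# OPTIONS --safe #-}
module Submission where

-- Number the vertices along the cycle of non-edges, a_i ↦ 2i and b_i ↦ 2i+1 (0-indexed), so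
-- that G_n^5 is the complement of the cycle 0 → 1 → ⋯ → 2n−1 → 0. Let E be 0 1 … 2n−1 with
-- every pair {2k, 2k+1} swapped, O be 0 1 … 2n−2 with every pair {2k+1, 2k+2} swapped, and
-- w = E O 0. For u < v both E and O list u before v, except that E reverses v = u+1 for even u
-- and O reverses it for odd u; so the restriction of w to {u, v} alternates exactly when
-- v ≠ u+1. The final 0 only prolongs 0 v 0 v for the other pairs containing 0, but catches the
-- wrap-around pair {0, 2n−1}: as 2n−1 does not occur in O, that restriction is 0 (2n−1) 0 0.

open import Defs
open import Data.Empty using (⊥-elim)
open import Data.Fin using (Fin; toℕ; combine; remQuot)
open import Data.Fin.Patterns using (0F; 1F)
open import Data.Fin.Properties
  using (toℕ<n; toℕ-injective; toℕ-fromℕ<; toℕ-combine; remQuot-combine; combine-remQuot)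
open import Data.List using (List; []; _∷_; _++_; _∷ʳ_; map; filter; upTo; applyUpTo)
open import Data.List.Properties
  using (++-identityʳ; filter-accept; filter-reject; filter-++; filter-≐; upTo-∷ʳ; map-upTo)
open import Data.List.Relation.Unary.All using (All; []; _∷_; universal)
open import Data.List.Relation.Unary.All.Properties using (filter⁺; ++⁺; applyUpTo⁺₁)
open import Data.Nat using (ℕ; zero; suc; _+_; _*_; _≤_; _<_; _≥_; s≤s; z≤n)
open import Data.Nat.DivMod using (_mod_; _%_; m<n⇒m%n≡m)
open import Data.Nat.Properties
  using (_≟_; ≤-refl; ≤-trans; <-trans; <-≤-trans; <⇒≤; <-irrefl; <⇒≢; >⇒≢; <⇒≱; <-cmp; n≤1+n;
         m<n⇒m<1+n; m≤n⇒m<n∨m≡n; suc-injective; +-identityʳ; +-comm; *-comm; *-cancelʳ-≡; even≢odd)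
open import Data.Product using (Σ; _×_; _,_; proj₁; proj₂; uncurry)
open import Data.Product.Function.NonDependent.Propositional using (_×-⇔_)
open import Data.Sum using (_⊎_; inj₁; inj₂)
import Data.Sum as Sum
open import Data.Sum.Function.Propositional using (_⊎-⇔_)
open import Data.Unit using (tt)
open import Function using (_∘_)
open import Function.Bundles using (_⇔_; mk⇔; Equivalence)
open import Function.Properties.Equivalence using () renaming (sym to ⇔-sym)
open import Function.Related.Propositional using (module EquationalReasoning)
open import Function.Related.TypeIsomorphisms using (¬-cong-⇔)
open import Relation.Binary.Definitions using (DecidableEquality; tri<; tri≈; tri>)
open import Relation.Binary.PropositionalEquality
open import Relation.Nullary using (¬_; yes; no)
open import Relation.Nullary.Decidable using (_⊎-dec_)
open import Relation.Unary using (Decidable)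

either? : {A : Set} → DecidableEquality A → (i j : A) → Decidable (λ z → z ≡ i ⊎ z ≡ j)
either? _≟_ i j z = (z ≟ i) ⊎-dec (z ≟ j)

neither : ∀ {A : Set} {i j k : A} → k ≢ i → k ≢ j → ¬ (k ≡ i ⊎ k ≡ j)
neither k≢i k≢j = Sum.[ k≢i , k≢j ]

restrict-comm : ∀ {A : Set} (_≟_ : DecidableEquality A) i j w → restrict _≟_ i j w ≡ restrict _≟_ j i w
restrict-comm _≟_ i j = filter-≐ (either? _≟_ i j) (either? _≟_ j i) (Sum.swap , Sum.swap)

module _ {A B : Set} (_≟A_ : DecidableEquality A) (_≟B_ : DecidableEquality B)
         {P : B → Set} {f : B → A} (f-injective : ∀ {k l} → P k → P l → f k ≡ f l → k ≡ l) where

  restrict-map : ∀ {k l w} → P k → P l → All P w →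
                 restrict _≟A_ (f k) (f l) (map f w) ≡ map f (restrict _≟B_ k l w)
  restrict-map pk pl [] = refl
  restrict-map {k} {l} {z ∷ w} pk pl (pz ∷ pw) with (z ≟B k) ⊎-dec (z ≟B l)
  ... | yes z∈kl = begin
    restrict _≟A_ (f k) (f l) (f z ∷ map f w) ≡⟨ filter-accept fkl? (Sum.map (cong f) (cong f) z∈kl) ⟩
    f z ∷ restrict _≟A_ (f k) (f l) (map f w) ≡⟨ cong (f z ∷_) (restrict-map pk pl pw) ⟩
    map f (z ∷ restrict _≟B_ k l w)           ≡⟨ cong (map f) (filter-accept (either? _≟B_ k l) z∈kl) ⟨
    map f (restrict _≟B_ k l (z ∷ w))         ∎
    where
    open ≡-Reasoning
    fkl? = either? _≟A_ (f k) (f l)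
  ... | no z∉kl = begin
    restrict _≟A_ (f k) (f l) (f z ∷ map f w)
      ≡⟨ filter-reject fkl? (z∉kl ∘ Sum.map (f-injective pz pk) (f-injective pz pl)) ⟩
    restrict _≟A_ (f k) (f l) (map f w)       ≡⟨ restrict-map pk pl pw ⟩
    map f (restrict _≟B_ k l w)               ≡⟨ cong (map f) (filter-reject (either? _≟B_ k l) z∉kl) ⟨
    map f (restrict _≟B_ k l (z ∷ w))         ∎
    where
    open ≡-Reasoning
    fkl? = either? _≟A_ (f k) (f l)

  NoRepeatFactor-map : ∀ {w} → All P w → NoRepeatFactor (map f w) ⇔ NoRepeatFactor w
  NoRepeatFactor-map pw = mk⇔ (to pw) (from pw)
    where
    to : ∀ {w} → All P w → NoRepeatFactor (map f w) → NoRepeatFactor w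
    to []               _            = tt
    to (_ ∷ [])         _            = tt
    to (_ ∷ pw@(_ ∷ _)) (fx≢fy , nr) = fx≢fy ∘ cong f , to pw nr
    from : ∀ {w} → All P w → NoRepeatFactor w → NoRepeatFactor (map f w)
    from []                 _          = tt
    from (_ ∷ [])           _          = tt
    from (px ∷ pw@(py ∷ _)) (x≢y , nr) = x≢y ∘ f-injective px py , from pw nr

  Alternate-map : ∀ {k l w} → P k → P l → All P w →
                  Alternate _≟A_ (map f w) (f k) (f l) ⇔ Alternate _≟B_ w k l
  Alternate-map pk pl pw rewrite restrict-map pk pl pw = NoRepeatFactor-map (filter⁺ _ pw)

module _ {P : ℕ → Set} (P? : Decidable P) where

  filter-upTo-suc : ∀ K → filter P? (upTo (suc K)) ≡ filter P? (upTo K) ++ filter P? (K ∷ [])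
  filter-upTo-suc K = trans (cong (filter P?) (sym (upTo-∷ʳ K))) (filter-++ P? (upTo K) (K ∷ []))

  filter-upTo-skip : ∀ {K K′} → K ≤ K′ → (∀ {k} → K ≤ k → k < K′ → ¬ P k) →
                     filter P? (upTo K′) ≡ filter P? (upTo K)
  filter-upTo-skip {K} K≤K′ miss with m≤n⇒m<n∨m≡n K≤K′
  ... | inj₂ refl = refl
  ... | inj₁ (s≤s {n = K″} K≤K″) = begin
    filter P? (upTo (suc K″))                  ≡⟨ filter-upTo-suc K″ ⟩
    filter P? (upTo K″) ++ filter P? (K″ ∷ []) ≡⟨ cong (filter P? (upTo K″) ++_) K″-rejected ⟩
    filter P? (upTo K″) ++ []                  ≡⟨ ++-identityʳ _ ⟩
    filter P? (upTo K″)                        ≡⟨ filter-upTo-skip K≤K″ (λ K≤k → miss K≤k ∘ m<n⇒m<1+n) ⟩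
    filter P? (upTo K)                         ∎
    where
    open ≡-Reasoning
    K″-rejected = filter-reject P? (miss K≤K″ ≤-refl)

  filter-upTo-none : ∀ {K} → (∀ {k} → k < K → ¬ P k) → filter P? (upTo K) ≡ []
  filter-upTo-none miss = filter-upTo-skip z≤n (λ _ → miss)

  filter-upTo-last : ∀ {j K} → j < K → P j → (∀ {k} → j < k → k < K → ¬ P k) →
                     filter P? (upTo K) ≡ filter P? (upTo j) ∷ʳ j
  filter-upTo-last {j} j<K pj miss =
    trans (filter-upTo-skip j<K miss)
          (trans (filter-upTo-suc j) (cong (filter P? (upTo j) ++_) (filter-accept P? pj)))

module _ {i j : ℕ} where

  private
    ij? = either? _≟_ i j

  restrict-upTo-pair : ∀ {K} → i < j → j < K → restrict _≟_ i j (upTo K) ≡ i ∷ j ∷ []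
  restrict-upTo-pair {K} i<j j<K = begin
    filter ij? (upTo K)           ≡⟨ filter-upTo-last ij? j<K (inj₂ refl) above-j ⟩
    filter ij? (upTo j) ∷ʳ j      ≡⟨ cong (_∷ʳ j) (filter-upTo-last ij? i<j (inj₁ refl) between) ⟩
    filter ij? (upTo i) ∷ʳ i ∷ʳ j ≡⟨ cong (λ xs → xs ∷ʳ i ∷ʳ j) (filter-upTo-none ij? below-i) ⟩
    i ∷ j ∷ []                    ∎
    where
    open ≡-Reasoning
    above-j : ∀ {k} → j < k → k < K → ¬ (k ≡ i ⊎ k ≡ j)
    above-j j<k _ = neither (>⇒≢ (<-trans i<j j<k)) (>⇒≢ j<k)
    between : ∀ {k} → i < k → k < j → ¬ (k ≡ i ⊎ k ≡ j)
    between i<k k<j = neither (>⇒≢ i<k) (<⇒≢ k<j)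
    below-i : ∀ {k} → k < i → ¬ (k ≡ i ⊎ k ≡ j)
    below-i k<i = neither (<⇒≢ k<i) (<⇒≢ (<-trans k<i i<j))

  restrict-upTo-single : ∀ {K} → i < K → K ≤ j → restrict _≟_ i j (upTo K) ≡ i ∷ []
  restrict-upTo-single {K} i<K K≤j = begin
    filter ij? (upTo K)      ≡⟨ filter-upTo-last ij? i<K (inj₁ refl) above-i ⟩
    filter ij? (upTo i) ∷ʳ i ≡⟨ cong (_∷ʳ i) (filter-upTo-none ij? below-i) ⟩
    i ∷ []                   ∎
    where
    open ≡-Reasoning
    above-i : ∀ {k} → i < k → k < K → ¬ (k ≡ i ⊎ k ≡ j)
    above-i i<k k<K = neither (>⇒≢ i<k) (<⇒≢ (<-≤-trans k<K K≤j))
    below-i : ∀ {k} → k < i → ¬ (k ≡ i ⊎ k ≡ j)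
    below-i k<i = neither (<⇒≢ k<i) (<⇒≢ (<-≤-trans k<i (≤-trans (<⇒≤ i<K) K≤j)))

module _ {π : ℕ → ℕ} (π-injective : ∀ {k l} → π k ≡ π l → k ≡ l) {i j K : ℕ} where

  private
    restrict-applyUpTo : restrict _≟_ (π i) (π j) (applyUpTo π K) ≡ map π (restrict _≟_ i j (upTo K))
    restrict-applyUpTo =
      trans (cong (restrict _≟_ (π i) (π j)) (sym (map-upTo π K)))
            (restrict-map _≟_ _≟_ (λ _ _ → π-injective) tt tt (universal (λ _ → tt) (upTo K)))

  restrict-applyUpTo-pair : i < j → j < K → restrict _≟_ (π i) (π j) (applyUpTo π K) ≡ π i ∷ π j ∷ []
  restrict-applyUpTo-pair i<j j<K = trans restrict-applyUpTo (cong (map π) (restrict-upTo-pair i<j j<K))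

  restrict-applyUpTo-single : i < K → K ≤ j → restrict _≟_ (π i) (π j) (applyUpTo π K) ≡ π i ∷ []
  restrict-applyUpTo-single i<K K≤j = trans restrict-applyUpTo (cong (map π) (restrict-upTo-single i<K K≤j))

module _ {π : ℕ → ℕ} (π-involutive : ∀ k → π (π k) ≡ k) where

  private
    π-injective : ∀ {k l} → π k ≡ π l → k ≡ l
    π-injective {k} {l} πk≡πl = trans (sym (π-involutive k)) (trans (cong π πk≡πl) (π-involutive l))

  restrict-involution-pair : ∀ {u v K} → π u < π v → π v < K →
                             restrict _≟_ u v (applyUpTo π K) ≡ u ∷ v ∷ []
  restrict-involution-pair {u} {v} {K} πu<πv πv<K =
    subst₂ (λ x y → restrict _≟_ x y (applyUpTo π K) ≡ x ∷ y ∷ [])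
           (π-involutive u) (π-involutive v) (restrict-applyUpTo-pair π-injective πu<πv πv<K)

  restrict-involution-swapped : ∀ {u v K} → u < v → v ≡ π u → v < K →
                                restrict _≟_ u v (applyUpTo π K) ≡ v ∷ u ∷ []
  restrict-involution-swapped {u} {v} {K} u<v v≡πu v<K =
    trans (restrict-comm _≟_ u v (applyUpTo π K))
          (restrict-involution-pair (subst₂ _<_ (sym πv≡u) v≡πu u<v) (subst (_< K) v≡πu v<K))
    where
    πv≡u : π v ≡ u
    πv≡u = trans (cong π v≡πu) (π-involutive u)

  restrict-involution-single : ∀ {u v K} → π u < K → K ≤ π v →
                               restrict _≟_ u v (applyUpTo π K) ≡ u ∷ []
  restrict-involution-single {u} {v} {K} πu<K K≤πv =
    subst₂ (λ x y → restrict _≟_ x y (applyUpTo π K) ≡ x ∷ [])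
           (π-involutive u) (π-involutive v) (restrict-applyUpTo-single π-injective πu<K K≤πv)

flipEven : ℕ → ℕ
flipEven zero          = 1
flipEven (suc zero)    = 0
flipEven (suc (suc k)) = suc (suc (flipEven k))

flipOdd : ℕ → ℕ
flipOdd zero    = zero
flipOdd (suc k) = suc (flipEven k)

flipEven-involutive : ∀ k → flipEven (flipEven k) ≡ k
flipEven-involutive zero          = refl
flipEven-involutive (suc zero)    = refl
flipEven-involutive (suc (suc k)) = cong (suc ∘ suc) (flipEven-involutive k)

flipOdd-involutive : ∀ k → flipOdd (flipOdd k) ≡ k
flipOdd-involutive zero    = refl
flipOdd-involutive (suc k) = cong suc (flipEven-involutive k)

flipEven-< : ∀ m {k} → k < m * 2 → flipEven k < m * 2
flipEven-< (suc m) {zero}        _               = s≤s (s≤s z≤n)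
flipEven-< (suc m) {suc zero}    _               = s≤s z≤n
flipEven-< (suc m) {suc (suc k)} (s≤s (s≤s k<)) = s≤s (s≤s (flipEven-< m k<))

flipOdd-< : ∀ m {k} → k < suc (m * 2) → flipOdd k < suc (m * 2)
flipOdd-< m {zero}  _        = s≤s z≤n
flipOdd-< m {suc k} (s≤s k<) = s≤s (flipEven-< m k<)

flipEven-double : ∀ m → flipEven (m * 2) ≡ suc (m * 2)
flipEven-double zero    = refl
flipEven-double (suc m) = cong (suc ∘ suc) (flipEven-double m)

flipEven-monotone : ∀ {u v} → u < v → v ≢ flipEven u → flipEven u < flipEven v
flipEven-monotone {zero}        {suc zero}    _               v≢1  = ⊥-elim (v≢1 refl)
flipEven-monotone {zero}        {suc (suc v)} _               _    = s≤s (s≤s z≤n)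
flipEven-monotone {suc zero}    {suc zero}    (s≤s ())
flipEven-monotone {suc zero}    {suc (suc v)} _               _    = s≤s z≤n
flipEven-monotone {suc (suc u)} {suc (suc v)} (s≤s (s≤s u<v)) v≢σu =
  s≤s (s≤s (flipEven-monotone u<v (v≢σu ∘ cong (suc ∘ suc))))

flipOdd-monotone : ∀ {u v} → u < v → v ≢ flipOdd u → flipOdd u < flipOdd v
flipOdd-monotone {zero}  {suc v} _         _    = s≤s z≤n
flipOdd-monotone {suc u} {suc v} (s≤s u<v) v≢ρu = s≤s (flipEven-monotone u<v (v≢ρu ∘ cong suc))

flipEven-above : ∀ {u} → u < flipEven u → flipEven u ≡ suc u
flipEven-above {zero}        _               = refl
flipEven-above {suc (suc u)} (s≤s (s≤s u<)) = cong (suc ∘ suc) (flipEven-above u<)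

flipOdd-above : ∀ {u} → u < flipOdd u → flipOdd u ≡ suc u
flipOdd-above {suc u} (s≤s u<) = cong suc (flipEven-above u<)

flipEven≢flipOdd : ∀ k → flipEven k ≢ flipOdd k
flipEven≢flipOdd 0 = λ ()
flipEven≢flipOdd 1 = λ ()
flipEven≢flipOdd 2 = λ ()
flipEven≢flipOdd 3 = λ ()
flipEven≢flipOdd (suc (suc (suc (suc k)))) = flipEven≢flipOdd (suc (suc k)) ∘ suc-injective ∘ suc-injective

flipEven⊎flipOdd-suc : ∀ k → flipEven k ≡ suc k ⊎ flipOdd k ≡ suc k
flipEven⊎flipOdd-suc 0 = inj₁ refl
flipEven⊎flipOdd-suc 1 = inj₂ refl
flipEven⊎flipOdd-suc 2 = inj₁ refl
flipEven⊎flipOdd-suc 3 = inj₂ refl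
flipEven⊎flipOdd-suc (suc (suc (suc (suc k)))) =
  Sum.map (cong (suc ∘ suc)) (cong (suc ∘ suc)) (flipEven⊎flipOdd-suc (suc (suc k)))

Consecutive : ℕ → ℕ → ℕ → Set
Consecutive N k l = l ≡ suc k ⊎ (suc k ≡ N × l ≡ 0)

CycleNonEdge : ℕ → ℕ → ℕ → Set
CycleNonEdge N k l = Consecutive N k l ⊎ Consecutive N l k

CycleNonEdge-sym : ∀ {N k l} → CycleNonEdge N k l → CycleNonEdge N l k
CycleNonEdge-sym = Sum.swap

¬CycleNonEdge-< : ∀ {N u v} → u < v → v ≢ suc u → (suc v ≡ N → u ≢ 0) → ¬ CycleNonEdge N u v
¬CycleNonEdge-< _   v≢1+u _       (inj₁ (inj₁ v≡1+u))         = v≢1+u v≡1+u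
¬CycleNonEdge-< ()  _     _       (inj₁ (inj₂ (_ , refl)))
¬CycleNonEdge-< u<v _     _       (inj₂ (inj₁ refl))          = <⇒≱ u<v (n≤1+n _)
¬CycleNonEdge-< _   _     no-wrap (inj₂ (inj₂ (1+v≡N , u≡0))) = no-wrap 1+v≡N u≡0

coCycleWord : ℕ → List ℕ
coCycleWord m = applyUpTo flipEven (suc m * 2) ++ applyUpTo flipOdd (suc (m * 2)) ++ 0 ∷ []

coCycleWord-bounded : ∀ m → All (_< suc m * 2) (coCycleWord m)
coCycleWord-bounded m =
  ++⁺ (applyUpTo⁺₁ flipEven (suc m * 2) (flipEven-< (suc m)))
      (++⁺ (applyUpTo⁺₁ flipOdd (suc (m * 2)) (m<n⇒m<1+n ∘ flipOdd-< m)) (s≤s z≤n ∷ []))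

module _ (m : ℕ) {u v : ℕ} (u<v : u < v) (v≤last : v ≤ suc (m * 2)) where

  private
    R : List ℕ → List ℕ
    R = restrict _≟_ u v

    E O : List ℕ
    E = applyUpTo flipEven (suc m * 2)
    O = applyUpTo flipOdd (suc (m * 2))

    u<last : u < suc (m * 2)
    u<last = <-≤-trans u<v v≤last

    u≢v : u ≢ v
    u≢v = <⇒≢ u<v

    v≢0 : v ≢ 0
    v≢0 = >⇒≢ (≤-trans (s≤s z≤n) u<v)

    split : ∀ {e o z} → R E ≡ e → R O ≡ o → R (0 ∷ []) ≡ z → R (coCycleWord m) ≡ e ++ o ++ z
    split Re Ro Rz = begin
      R (coCycleWord m)           ≡⟨ filter-++ (either? _≟_ u v) E _ ⟩
      R E ++ R (O ++ 0 ∷ [])      ≡⟨ cong (R E ++_) (filter-++ (either? _≟_ u v) O _) ⟩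
      R E ++ R O ++ R (0 ∷ [])    ≡⟨ cong₂ _++_ Re (cong₂ _++_ Ro Rz) ⟩
      _                           ∎
      where open ≡-Reasoning

    even-ordered : v ≢ flipEven u → R E ≡ u ∷ v ∷ []
    even-ordered v≢σu = restrict-involution-pair {flipEven} flipEven-involutive
      (flipEven-monotone u<v v≢σu) (flipEven-< (suc m) (s≤s v≤last))

    even-swapped : v ≡ flipEven u → R E ≡ v ∷ u ∷ []
    even-swapped v≡σu = restrict-involution-swapped {flipEven} flipEven-involutive u<v v≡σu (s≤s v≤last)

    odd-ordered : v < suc (m * 2) → v ≢ flipOdd u → R O ≡ u ∷ v ∷ []
    odd-ordered v<last v≢ρu = restrict-involution-pair {flipOdd} flipOdd-involutive
      (flipOdd-monotone u<v v≢ρu) (flipOdd-< m v<last)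

    odd-last : v ≡ suc (m * 2) → R O ≡ u ∷ []
    odd-last v≡last = restrict-involution-single {flipOdd} flipOdd-involutive (flipOdd-< m u<last)
      (subst (λ x → suc (m * 2) ≤ flipOdd x) (sym v≡last)
             (s≤s (subst (m * 2 ≤_) (sym (flipEven-double m)) (n≤1+n _))))

    odd-swapped : v ≡ flipOdd u → R O ≡ v ∷ u ∷ []
    odd-swapped v≡ρu = restrict-involution-swapped {flipOdd} flipOdd-involutive u<v v≡ρu
      (subst (_< suc (m * 2)) (sym v≡ρu) (flipOdd-< m u<last))

    odd-starts-with-u : v ≢ flipOdd u → Σ (List ℕ) λ rest → R O ≡ u ∷ rest
    odd-starts-with-u v≢ρu with m≤n⇒m<n∨m≡n v≤last
    ... | inj₁ v<last = v ∷ [] , odd-ordered v<last v≢ρu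
    ... | inj₂ v≡last = [] , odd-last v≡last

    zero-kept : u ≡ 0 → R (0 ∷ []) ≡ 0 ∷ []
    zero-kept u≡0 = filter-accept (either? _≟_ u v) (inj₁ (sym u≡0))

    zero-dropped : u ≢ 0 → R (0 ∷ []) ≡ []
    zero-dropped u≢0 = filter-reject (either? _≟_ u v) (neither (u≢0 ∘ sym) (v≢0 ∘ sym))

    successor-if-flipped : (π : ℕ → ℕ) → (u < π u → π u ≡ suc u) → v ≡ π u →
                           CycleNonEdge (suc m * 2) u v
    successor-if-flipped _ π-above v≡πu = inj₁ (inj₁ (trans v≡πu (π-above (subst (u <_) v≡πu u<v))))

    not-successor : v ≢ flipEven u → v ≢ flipOdd u → v ≢ suc u
    not-successor v≢σu v≢ρu v≡1+u =
      Sum.[ v≢σu ∘ trans v≡1+u ∘ sym , v≢ρu ∘ trans v≡1+u ∘ sym ] (flipEven⊎flipOdd-suc u)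

    no-wrap : v < suc (m * 2) → suc v ≡ suc m * 2 → u ≢ 0
    no-wrap v<last 1+v≡N _ = <-irrefl (suc-injective 1+v≡N) v<last

    represented : ∀ {L} → R (coCycleWord m) ≡ L → NoRepeatFactor L → ¬ CycleNonEdge (suc m * 2) u v →
                  Alternate _≟_ (coCycleWord m) u v ⇔ (¬ CycleNonEdge (suc m * 2) u v)
    represented RL nr ¬ne = mk⇔ (λ _ → ¬ne) (λ _ → subst NoRepeatFactor (sym RL) nr)

    unrepresented : ∀ {L} → R (coCycleWord m) ≡ L → ¬ NoRepeatFactor L → CycleNonEdge (suc m * 2) u v →
                    Alternate _≟_ (coCycleWord m) u v ⇔ (¬ CycleNonEdge (suc m * 2) u v)
    unrepresented RL ¬nr ne = mk⇔ (⊥-elim ∘ ¬nr ∘ subst NoRepeatFactor RL) (λ ¬ne → ⊥-elim (¬ne ne))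

  coCycleWord-represents-< : Alternate _≟_ (coCycleWord m) u v ⇔ (¬ CycleNonEdge (suc m * 2) u v)
  coCycleWord-represents-< with v ≟ flipEven u | v ≟ flipOdd u
  ... | yes v≡σu | yes v≡ρu = ⊥-elim (flipEven≢flipOdd u (trans (sym v≡σu) v≡ρu))
  ... | yes v≡σu | no v≢ρu =
    unrepresented (split (even-swapped v≡σu) (proj₂ (odd-starts-with-u v≢ρu)) refl)
      (λ (_ , u≢u , _) → u≢u refl)
      (successor-if-flipped flipEven flipEven-above v≡σu)
  ... | no v≢σu | yes v≡ρu =
    unrepresented (split (even-ordered v≢σu) (odd-swapped v≡ρu) refl) (λ (_ , v≢v , _) → v≢v refl)
      (successor-if-flipped flipOdd flipOdd-above v≡ρu)
  ... | no v≢σu | no v≢ρu with m≤n⇒m<n∨m≡n v≤last | u ≟ 0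
  ...   | inj₂ v≡last | yes u≡0 =
    unrepresented (split (even-ordered v≢σu) (odd-last v≡last) (zero-kept u≡0))
      (λ (_ , _ , u≢0 , _) → u≢0 u≡0)
      (inj₂ (inj₂ (cong suc v≡last , u≡0)))
  ...   | inj₂ v≡last | no u≢0 =
    represented (split (even-ordered v≢σu) (odd-last v≡last) (zero-dropped u≢0)) (u≢v , u≢v ∘ sym , tt)
      (¬CycleNonEdge-< u<v (not-successor v≢σu v≢ρu) (λ _ → u≢0))
  ...   | inj₁ v<last | yes u≡0 =
    represented (split (even-ordered v≢σu) (odd-ordered v<last v≢ρu) (zero-kept u≡0))
      (u≢v , u≢v ∘ sym , u≢v , v≢0 , tt)
      (¬CycleNonEdge-< u<v (not-successor v≢σu v≢ρu) (no-wrap v<last))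
  ...   | inj₁ v<last | no u≢0 =
    represented (split (even-ordered v≢σu) (odd-ordered v<last v≢ρu) (zero-dropped u≢0))
      (u≢v , u≢v ∘ sym , u≢v , tt)
      (¬CycleNonEdge-< u<v (not-successor v≢σu v≢ρu) (no-wrap v<last))

coCycleWord-represents : ∀ m {k l} → k < suc m * 2 → l < suc m * 2 → k ≢ l →
                         Alternate _≟_ (coCycleWord m) k l ⇔ (¬ CycleNonEdge (suc m * 2) k l)
coCycleWord-represents m {k} {l} (s≤s k≤last) (s≤s l≤last) k≢l with <-cmp k l
... | tri< k<l _ _ = coCycleWord-represents-< m k<l l≤last
... | tri≈ _ k≡l _ = ⊥-elim (k≢l k≡l)
... | tri> _ _ l<k =
  mk⇔ (λ alt → Equivalence.to lk (subst NoRepeatFactor kl≡lk alt) ∘ CycleNonEdge-sym)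
      (λ ¬ne → subst NoRepeatFactor (sym kl≡lk) (Equivalence.from lk (¬ne ∘ CycleNonEdge-sym)))
  where
  lk = coCycleWord-represents-< m l<k k≤last
  kl≡lk = restrict-comm _≟_ k l (coCycleWord m)

position : ∀ {n} → Vtx n → ℕ
position (a i) = toℕ i * 2
position (b i) = suc (toℕ i * 2)

toPair : ∀ {n} → Vtx n → Fin n × Fin 2
toPair (a i) = i , 0F
toPair (b i) = i , 1F

fromPair : ∀ {n} → Fin n × Fin 2 → Vtx n
fromPair (i , 0F) = a i
fromPair (i , 1F) = b i

fromPair-toPair : ∀ {n} (x : Vtx n) → fromPair (toPair x) ≡ x
fromPair-toPair (a _) = refl
fromPair-toPair (b _) = refl

position-fromPair : ∀ {n} (p : Fin n × Fin 2) → position (fromPair p) ≡ toℕ (uncurry combine p)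
position-fromPair (i , 0F) = sym (begin
  toℕ (combine i 0F) ≡⟨ toℕ-combine i 0F ⟩
  2 * toℕ i + 0      ≡⟨ +-identityʳ _ ⟩
  2 * toℕ i          ≡⟨ *-comm 2 (toℕ i) ⟩
  toℕ i * 2          ∎)
  where open ≡-Reasoning
position-fromPair (i , 1F) = sym (begin
  toℕ (combine i 1F) ≡⟨ toℕ-combine i 1F ⟩
  2 * toℕ i + 1      ≡⟨ +-comm _ 1 ⟩
  suc (2 * toℕ i)    ≡⟨ cong suc (*-comm 2 (toℕ i)) ⟩
  suc (toℕ i * 2)    ∎)
  where open ≡-Reasoning

position-toPair : ∀ {n} (x : Vtx n) → position x ≡ toℕ (uncurry combine (toPair x))
position-toPair (a i) = position-fromPair (i , 0F)
position-toPair (b i) = position-fromPair (i , 1F)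

position-< : ∀ {n} (x : Vtx n) → position x < n * 2
position-< x = subst (_< _) (sym (position-toPair x)) (toℕ<n _)

-- Positions k ≥ (suc m) * 2 are first reduced modulo (suc m) * 2.
vertexAt : ∀ {m} → ℕ → Vtx (suc m)
vertexAt {m} k = fromPair (remQuot {suc m} 2 (k mod (suc m * 2)))

vertexAt-position : ∀ {m} (x : Vtx (suc m)) → vertexAt (position x) ≡ x
vertexAt-position {m} x = begin
  fromPair (remQuot {suc m} 2 (position x mod (suc m * 2))) ≡⟨ cong (fromPair ∘ remQuot {suc m} 2) mod≡ ⟩
  fromPair (remQuot {suc m} 2 (uncurry combine (toPair x))) ≡⟨ cong fromPair (remQuot-combine {suc m} {2} _ _) ⟩
  fromPair (toPair x)                                       ≡⟨ fromPair-toPair x ⟩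
  x                                                         ∎
  where
  open ≡-Reasoning
  mod≡ : position x mod (suc m * 2) ≡ uncurry combine (toPair x)
  mod≡ = toℕ-injective (trans (toℕ-fromℕ< _) (trans (m<n⇒m%n≡m (position-< x)) (position-toPair x)))

position-vertexAt : ∀ {m k} → k < suc m * 2 → position (vertexAt {m} k) ≡ k
position-vertexAt {m} {k} k<N = begin
  position (fromPair pair)        ≡⟨ position-fromPair pair ⟩
  toℕ (uncurry combine pair)      ≡⟨ cong toℕ (combine-remQuot {suc m} 2 _) ⟩
  toℕ (k mod (suc m * 2))         ≡⟨ toℕ-fromℕ< _ ⟩
  k % (suc m * 2)                 ≡⟨ m<n⇒m%n≡m k<N ⟩
  k                               ∎
  where
  open ≡-Reasoning
  pair = remQuot {suc m} 2 (k mod (suc m * 2))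

position-injective : ∀ {m} {x y : Vtx (suc m)} → position x ≡ position y → x ≡ y
position-injective {x = x} {y} eq = trans (sym (vertexAt-position x)) (trans (cong vertexAt eq) (vertexAt-position y))

vertexAt-injective : ∀ {m k l} → k < suc m * 2 → l < suc m * 2 → vertexAt {m} k ≡ vertexAt l → k ≡ l
vertexAt-injective k<N l<N eq = trans (sym (position-vertexAt k<N)) (trans (cong position eq) (position-vertexAt l<N))

private
  double-cong : ∀ i j → i ≡ j ⇔ i * 2 ≡ j * 2
  double-cong i j = mk⇔ (cong (_* 2)) (*-cancelʳ-≡ i j 2)

  even≢odd′ : ∀ i j → i * 2 ≢ suc (j * 2)
  even≢odd′ i j eq = even≢odd i j (trans (*-comm 2 i) (trans eq (cong suc (*-comm j 2))))

NonEdge₀⇔Consecutive : ∀ {n} (x y : Vtx n) → NonEdge₀ n x y ⇔ Consecutive (n * 2) (position x) (position y)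
NonEdge₀⇔Consecutive {n} (a i) (a j) =
  mk⇔ (λ ()) Sum.[ even≢odd′ (toℕ j) (toℕ i) , even≢odd′ n (toℕ i) ∘ sym ∘ proj₁ ]
NonEdge₀⇔Consecutive (a i) (b j) =
  mk⇔ (inj₁ ∘ cong (suc ∘ (_* 2)) ∘ sym)
      Sum.[ sym ∘ *-cancelʳ-≡ (toℕ j) (toℕ i) 2 ∘ suc-injective , (λ ()) ∘ proj₂ ]
-- Here NonEdge₀ is literally Consecutive n (toℕ i) (toℕ j), and suc (suc (t * 2)) reduces to suc t * 2.
NonEdge₀⇔Consecutive {n} (b i) (a j) =
  double-cong (toℕ j) (suc (toℕ i)) ⊎-⇔ (double-cong (suc (toℕ i)) n ×-⇔ double-cong (toℕ j) 0)
NonEdge₀⇔Consecutive (b i) (b j) =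
  mk⇔ (λ ()) Sum.[ even≢odd′ (toℕ j) (toℕ i) ∘ suc-injective , (λ ()) ∘ proj₂ ]

NonEdge⇔CycleNonEdge : ∀ {n} (x y : Vtx n) → NonEdge n x y ⇔ CycleNonEdge (n * 2) (position x) (position y)
NonEdge⇔CycleNonEdge x y = NonEdge₀⇔Consecutive x y ⊎-⇔ NonEdge₀⇔Consecutive y x

theorem5 : (n : ℕ) → n ≥ 3 → WordRepresentable (G5 n)
theorem5 (suc m) _ = map vertexAt (coCycleWord m) , represents
  where
  open EquationalReasoning
  w = coCycleWord m
  represents : ∀ x y → x ≢ y → Adj5 (suc m) x y ⇔ Alternate _≟Vtx_ (map vertexAt w) x y
  represents x y x≢y = begin
    Adj5 (suc m) x y                                       ∼⟨ mk⇔ proj₂ (x≢y ,_) ⟩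
    ¬ NonEdge (suc m) x y                                  ∼⟨ ¬-cong-⇔ (NonEdge⇔CycleNonEdge x y) ⟩
    ¬ CycleNonEdge (suc m * 2) (position x) (position y)
      ∼⟨ ⇔-sym (coCycleWord-represents m (position-< x) (position-< y) (x≢y ∘ position-injective)) ⟩
    Alternate _≟_ w (position x) (position y)
      ∼⟨ ⇔-sym (Alternate-map _≟Vtx_ _≟_ vertexAt-injective
                 (position-< x) (position-< y) (coCycleWord-bounded m)) ⟩
    Alternate _≟Vtx_ (map vertexAt w) (vertexAt (position x)) (vertexAt (position y))
      ≡⟨ cong₂ (Alternate _≟Vtx_ (map vertexAt w)) (vertexAt-position x) (vertexAt-position y) ⟩
    Alternate _≟Vtx_ (map vertexAt w) x y                  ∎
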